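{- For $n\ge 2$, every edge of the $n$-dimensional varietal hypercube $VQ_n$ is contained in a cycle of length $4$.
   Context: The $n$-dimensional varietal hypercube $VQ_n$ is defined recursively on the vertex set of binary strings of length $n$. $VQ_1$ is the complete graph on the two vertices $0$ and $1$. For $n>1$, let $VQ^0_{n-1}$ (resp. $VQ^1_{n-1}$) be the graph obtained from $VQ_{n-1}$ by prefixing $0$ (resp. $1$) to every vertex label. $VQ_n$ consists of $VQ^0_{n-1}$ and $VQ^1_{n-1}$ together with the following edges: a vertex $x=0x_{n-1}\cdots x_1$ and a vertex $y=1y_{n-1}\cdots y_1$ are adjacent if and only if either (1) $n$ is not a multiple of $3$ and $x_{n-1}\cdots x_1=y_{n-1}\cdots y_1$, or (2) $n$ is a multiple of $3$, $x_{n-3}\cdots x_1=y_{n-3}\cdots y_1$ and $(x_{n-1}x_{n-2},y_{n-1}y_{n-2})\in\{(00,00),(01,01),(10,11),(11,10)\}$. -}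

module Defs where

open import Data.Nat using (ℕ; zero; suc)
open import Data.Nat.Divisibility using (_∣_)
open import Data.Bool using (Bool; true; false)
open import Data.Vec using (Vec; []; _∷_)
open import Data.Product using (_×_; ∃-syntax; _,_)
open import Relation.Binary.PropositionalEquality using (_≡_; _≢_)
open import Relation.Nullary using (¬_)

-- A vertex of VQ_n is a binary string x_n x_{n-1} ... x_1, stored as a
-- vector whose head is the leading (most significant) bit x_n.
Vertex : ℕ → Set
Vertex n = Vec Bool n

-- The allowed pairs (x_{n-1}x_{n-2}, y_{n-1}y_{n-2}) in case (2):
-- (00,00), (01,01), (10,11), (11,10).
data SpecialPair : Bool → Bool → Bool → Bool → Set where
  p00 : SpecialPair false false false false
  p01 : SpecialPair false true  false true
  p10 : SpecialPair true  false true  true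
  p11 : SpecialPair true  true  true  false

-- Cross n u v : the vertex 0u of VQ_{n+1} is joined to the vertex 1v
-- (u, v are the remaining n bits x_n ... x_1 and y_n ... y_1).
data Cross : (n : ℕ) → Vertex n → Vertex n → Set where
  plain   : ∀ {n} (x : Vertex n) → ¬ (3 ∣ suc n) → Cross n x x
  special : ∀ {m} {a b c d : Bool} {z : Vertex m} →
            3 ∣ suc (suc (suc m)) → SpecialPair a b c d →
            Cross (suc (suc m)) (a ∷ b ∷ z) (c ∷ d ∷ z)

-- Adjacency in VQ_n (undirected: both orientations of cross edges).
-- VQ_0 has no edges; VQ_1 = K_2 arises from the cross edge with n = 1.
data Adj : (n : ℕ) → Vertex n → Vertex n → Set where
  inside : ∀ {n} (b : Bool) {x y : Vertex n} → Adj n x y → Adj (suc n) (b ∷ x) (b ∷ y)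
  cross₀₁ : ∀ {n} {x y : Vertex n} → Cross n x y → Adj (suc n) (false ∷ x) (true ∷ y)
  cross₁₀ : ∀ {n} {x y : Vertex n} → Cross n x y → Adj (suc n) (true ∷ y) (false ∷ x)

OnFourCycle : (n : ℕ) → Vertex n → Vertex n → Set
OnFourCycle n x y =
  ∃[ u ] ∃[ w ]
    (Adj n y u × Adj n u w × Adj n w x ×
     x ≢ y × x ≢ u × x ≢ w × y ≢ u × y ≢ w × u ≢ w)

-- * Inside edges b x ~ b y of a copy VQ^b_{n-1}.  If the cross edges of
--   VQ_n are plain (3 ∤ n) the square is the prism b x, b y, b̄ y, b̄ x
--   (used for n = 2); otherwise the 4-cycle through x ~ y inside
--   VQ_{n-1} (induction, n - 1 ≥ 2) is lifted into the copy.
-- * Cross edges 0x ~ 1y.  Every cross edge has a parallel "rung"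
--   0x' ~ 1y' with x ~ x' and y ~ y' (flip the last bit for a plain
--   edge, the bit x_{n-2} for a special one), and the ladder
--   0x, 1y, 1y', 0x' is the 4-cycle.
--
-- All distinctness conditions reduce to irreflexivity of adjacency and
-- to the two copies having different leading bits.
module Submission where

open import Defs
open import Data.Nat using (ℕ; _≤_; zero; suc; s≤s; z≤n)
open import Data.Nat.Properties using (+-comm)
open import Data.Nat.Divisibility using (_∣_; ∣⇒≤; ∣m+n∣m⇒∣n)
open import Data.Bool using (Bool; true; false; not)
open import Data.Vec using ([]; _∷_)
open import Data.Vec.Properties using (∷-injectiveʳ)
open import Data.Product using (_×_; ∃-syntax; _,_)
open import Relation.Binary.PropositionalEquality using (_≢_; refl; sym; subst)
open import Relation.Nullary using (¬_)

3∤1 : ¬ (3 ∣ 1)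
3∤1 d with ∣⇒≤ d
... | s≤s ()

3∤2 : ¬ (3 ∣ 2)
3∤2 d with ∣⇒≤ d
... | s≤s (s≤s ())

-- Of two naturals at distance two at most one is a multiple of 3; so in
-- a dimension n ≡ 0 (mod 3) the dimension n - 2 has plain cross edges.
3∣m+3⇒3∤m+1 : ∀ m → 3 ∣ suc (suc (suc m)) → ¬ (3 ∣ suc m)
3∣m+3⇒3∤m+1 m 3∣m+3 3∣m+1 =
  3∤2 (∣m+n∣m⇒∣n (subst (3 ∣_) (+-comm 2 (suc m)) 3∣m+3) 3∣m+1)

adj-sym : ∀ {n x y} → Adj n x y → Adj n y x
adj-sym (inside b e) = inside b (adj-sym e)
adj-sym (cross₀₁ c)  = cross₁₀ c
adj-sym (cross₁₀ c)  = cross₀₁ c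

adj⇒≢ : ∀ {n x y} → Adj n x y → x ≢ y
adj⇒≢ (inside b e) refl = adj⇒≢ e refl

flip-lead : ∀ {n} b (v : Vertex n) → ¬ (3 ∣ suc n) → Adj (suc n) (b ∷ v) (not b ∷ v)
flip-lead false v 3∤n+1 = cross₀₁ (plain v 3∤n+1)
flip-lead true  v 3∤n+1 = cross₁₀ (plain v 3∤n+1)

-- Flipping the last bit x_1 is always an edge (VQ_1 = K_2).
flip-last : ∀ {k} → Vertex (suc k) → Vertex (suc k)
flip-last (b ∷ [])    = not b ∷ []
flip-last (b ∷ c ∷ v) = b ∷ flip-last (c ∷ v)

adj-flip-last : ∀ {k} (v : Vertex (suc k)) → Adj (suc k) v (flip-last v)
adj-flip-last (b ∷ [])    = flip-lead b [] 3∤1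
adj-flip-last (b ∷ c ∷ v) = inside b (adj-flip-last (c ∷ v))

special-flip : ∀ {a b c d} → SpecialPair a b c d → SpecialPair a (not b) c (not d)
special-flip p00 = p01
special-flip p01 = p00
special-flip p10 = p11
special-flip p11 = p10

cross-rung : ∀ {n x y} → Cross (suc n) x y →
             ∃[ x' ] ∃[ y' ] (Adj (suc n) x x' × Adj (suc n) y y' × Cross (suc n) x' y')
cross-rung (plain x 3∤n+2) =
  flip-last x , flip-last x , adj-flip-last x , adj-flip-last x , plain (flip-last x) 3∤n+2
cross-rung (special {m} {a} {b} {c} {d} {z} 3∣m+3 sp) =
  a ∷ not b ∷ z , c ∷ not d ∷ z ,
  inside a (flip-lead b z 3∤m+1) , inside c (flip-lead d z 3∤m+1) ,
  special 3∣m+3 (special-flip sp)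
  where
  3∤m+1 : ¬ (3 ∣ suc m)
  3∤m+1 = 3∣m+3⇒3∤m+1 m 3∣m+3

four-cycle-sym : ∀ {n x y} → OnFourCycle n y x → OnFourCycle n x y
four-cycle-sym (u , w , xu , uw , wy , y≢x , y≢u , y≢w , x≢u , x≢w , u≢w) =
  w , u , adj-sym wy , adj-sym uw , adj-sym xu ,
  (λ x≡y → y≢x (sym x≡y)) , x≢w , x≢u , y≢w , y≢u , (λ w≡u → u≢w (sym w≡u))

four-cycle-lift : ∀ {n x y} b → OnFourCycle n x y → OnFourCycle (suc n) (b ∷ x) (b ∷ y)
four-cycle-lift b (u , w , yu , uw , wx , x≢y , x≢u , x≢w , y≢u , y≢w , u≢w) =
  b ∷ u , b ∷ w , inside b yu , inside b uw , inside b wx ,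
  tail≢ x≢y , tail≢ x≢u , tail≢ x≢w , tail≢ y≢u , tail≢ y≢w , tail≢ u≢w
  where
  tail≢ : ∀ {v v' : Vertex _} → v ≢ v' → b ∷ v ≢ b ∷ v'
  tail≢ v≢v' eq = v≢v' (∷-injectiveʳ eq)

prism-square : ∀ {n x y} b → ¬ (3 ∣ suc n) → Adj n x y →
               OnFourCycle (suc n) (b ∷ x) (b ∷ y)
prism-square {x = x} {y} false 3∤n+1 e =
  true ∷ y , true ∷ x , flip-lead false y 3∤n+1 , inside true (adj-sym e) ,
  flip-lead true x 3∤n+1 ,
  (λ eq → adj⇒≢ e (∷-injectiveʳ eq)) , (λ ()) , (λ ()) , (λ ()) , (λ ()) ,
  (λ eq → adj⇒≢ e (sym (∷-injectiveʳ eq)))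
prism-square {x = x} {y} true 3∤n+1 e =
  false ∷ y , false ∷ x , flip-lead true y 3∤n+1 , inside false (adj-sym e) ,
  flip-lead false x 3∤n+1 ,
  (λ eq → adj⇒≢ e (∷-injectiveʳ eq)) , (λ ()) , (λ ()) , (λ ()) , (λ ()) ,
  (λ eq → adj⇒≢ e (sym (∷-injectiveʳ eq)))

ladder-square : ∀ {n x y x' y'} → Adj n x x' → Adj n y y' → Cross n x' y' →
                OnFourCycle (suc n) (false ∷ x) (true ∷ y)
ladder-square {x' = x'} {y'} xx' yy' c' =
  true ∷ y' , false ∷ x' , inside true yy' , cross₁₀ c' , inside false (adj-sym xx') ,
  (λ ()) , (λ ()) , (λ eq → adj⇒≢ xx' (∷-injectiveʳ eq)) ,
  (λ eq → adj⇒≢ yy' (∷-injectiveʳ eq)) , (λ ()) , (λ ())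

cross-square : ∀ {n x y} → Cross (suc n) x y →
               OnFourCycle (suc (suc n)) (false ∷ x) (true ∷ y)
cross-square c with cross-rung c
... | _ , _ , xx' , yy' , c' = ladder-square xx' yy' c'

lemma2p3 : (n : ℕ) → 2 ≤ n → (x y : Vertex n) → Adj n x y → OnFourCycle n x y
lemma2p3 (suc (suc zero)) _ _ _ (inside b e) = prism-square b 3∤2 e
lemma2p3 (suc (suc (suc n))) _ (b ∷ x) (.b ∷ y) (inside .b e) =
  four-cycle-lift b (lemma2p3 (suc (suc n)) (s≤s (s≤s z≤n)) x y e)
lemma2p3 (suc (suc n)) _ _ _ (cross₀₁ c) = cross-square c
lemma2p3 (suc (suc n)) _ _ _ (cross₁₀ c) = four-cycle-sym (cross-square c)
lemma2p3 (suc zero) (s≤s ()) _ _ _
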